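{- Let $\mathcal F$ be an algebraic language with no nullary symbols, $\mathbf I=([m];\mathcal F)$ a finite $\mathcal F$-algebra, $\mathbf A$ an $\mathcal F$-algebra with a surjective homomorphism $\chi\colon\mathbf A\to\mathbf I$, $\mathbf C:=\mathfrak C(\mathbf A,\chi)$, $\alpha:=\ker\chi$. For every congruence $\beta\le\alpha$ of $\mathbf A$ with $(0:\beta)\le\alpha$, we have $(0:\beta)^*=(0:\beta^*)$.
   Context: $[m]=\{1,\dots,m\}$, $D^{(i)}=\chi^{ -1}(i)$. $\mathfrak C(\mathbf A,\chi)$ has universe $C=D^{(1)}\times\dots\times D^{(m)}$ (columns $\mathbf c=(c^{(1)},\dots,c^{(m)})$), an $m$-ary operation $d(\mathbf c_1,\dots,\mathbf c_m)=(c_1^{(1)},\dots,c_m^{(m)})$, and for each $k$-ary $f\in\mathcal F$ and $\mathbf i\in[m]^k$ a $k$-ary operation $\hat f_{\mathbf i}(\mathbf c_1,\dots,\mathbf c_k)$: $\mathbf c_1$ with its $f^{\mathbf I}(\mathbf i)$-th entry replaced by $f^{\mathbf A}(c_1^{(i_1)},\dots,c_k^{(i_k)})$. For $\gamma\le\alpha$, $\gamma^*=\{(\mathbf a,\mathbf b)\in C^2:(a^{(i)},b^{(i)})\in\gamma\ \forall i\}$. The centralizer $(0:\beta)$ is the largest congruence $\rho$ with $[\rho,\beta]=0$, where $[\cdot,\cdot]$ is the term-condition commutator. -}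

module Defs where

open import Level using (0ℓ)
open import Data.Nat using (ℕ; _<_)
open import Data.Fin using (Fin; fromℕ<; _≟_)
open import Data.Sum using (_⊎_; [_,_])
open import Data.Product using (Σ; _,_; proj₁; proj₂)
open import Relation.Nullary using (yes; no)
open import Relation.Binary using (Rel; IsEquivalence)
open import Relation.Binary.PropositionalEquality
  using (_≡_; refl; sym; trans; cong; isEquivalence)

record Signature : Set₁ where
  field
    Op    : Set
    arity : Op → ℕ
open Signature public

NoNullary : Signature → Set
NoNullary S = ∀ f → 0 < arity S f

-- Plain algebras: a carrier X (with propositional equality) and
-- operations.  op-ext says operations are functions of their argument
-- tuples (automatic set-theoretically; needed since Agda lacks funext).

record Ops (S : Signature) (X : Set) : Set where
  field
    op     : (f : Op S) → (Fin (arity S f) → X) → X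
    op-ext : ∀ f (xs ys : Fin (arity S f) → X) →
             (∀ j → xs j ≡ ys j) → op f xs ≡ op f ys
open Ops public

-- Setoid algebras: carrier with an equality _≈_ playing the role of the
-- identity relation 0, operations respecting it.

record SAlg (S : Signature) : Set₁ where
  field
    Carrier : Set
    _≈_     : Rel Carrier 0ℓ
    ≈-equiv : IsEquivalence _≈_
    sop     : (f : Op S) → (Fin (arity S f) → Carrier) → Carrier
    sop-cong : ∀ f (xs ys : Fin (arity S f) → Carrier) →
               (∀ j → xs j ≈ ys j) → sop f xs ≈ sop f ys

plain : (S : Signature) (X : Set) → Ops S X → SAlg S
plain S X o = record
  { Carrier = X ; _≈_ = _≡_ ; ≈-equiv = isEquivalence
  ; sop = op o ; sop-cong = op-ext o }

data Term (S : Signature) (V : Set) : Set where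
  var : V → Term S V
  app : (f : Op S) → (Fin (arity S f) → Term S V) → Term S V

module _ {S : Signature} (𝔸 : SAlg S) where
  open SAlg 𝔸

  eval : {V : Set} → (V → Carrier) → Term S V → Carrier
  eval env (var v)    = env v
  eval env (app f ts) = sop f (λ j → eval env (ts j))

  _⊆_ : Rel Carrier 0ℓ → Rel Carrier 0ℓ → Set
  R ⊆ Q = ∀ {a b} → R a b → Q a b

  record IsCongruence (R : Rel Carrier 0ℓ) : Set where
    field
      isEquiv  : IsEquivalence R
      ≈⊆       : _≈_ ⊆ R
      compat   : ∀ f (xs ys : Fin (arity S f) → Carrier) →
                 (∀ j → R (xs j) (ys j)) → R (sop f xs) (sop f ys)

  TC : Rel Carrier 0ℓ → Rel Carrier 0ℓ → Rel Carrier 0ℓ → Set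
  TC ρ β δ = ∀ {p q : ℕ} (t : Term S (Fin p ⊎ Fin q))
               (a b : Fin p → Carrier) (c d : Fin q → Carrier) →
               (∀ i → ρ (a i) (b i)) → (∀ j → β (c j) (d j)) →
               δ (eval [ a , c ] t) (eval [ a , d ] t) →
               δ (eval [ b , c ] t) (eval [ b , d ] t)

  CommZero : Rel Carrier 0ℓ → Rel Carrier 0ℓ → Set
  CommZero ρ β = TC ρ β _≈_

  record IsCentralizer (ρ β : Rel Carrier 0ℓ) : Set₁ where
    field
      cong-ρ  : IsCongruence ρ
      comm0   : CommZero ρ β
      largest : ∀ σ → IsCongruence σ → CommZero σ β → σ ⊆ ρ

IsHom : (S : Signature) {X Y : Set} → Ops S X → Ops S Y → (X → Y) → Set
IsHom S oX oY h = ∀ f xs → h (op oX f xs) ≡ op oY f (λ j → h (xs j))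

Surjective : {X Y : Set} → (X → Y) → Set
Surjective {X} {Y} h = ∀ (y : Y) → Σ X (λ x → h x ≡ y)

ker : {X Y : Set} → (X → Y) → Rel X 0ℓ
ker h a b = h a ≡ h b

module Column (S : Signature) (nn : NoNullary S) (m : ℕ)
              (oI : Ops S (Fin m)) (A : Set) (oA : Ops S A)
              (χ : A → Fin m) (hom : IsHom S oA oI χ) where

  D : Fin m → Set
  D i = Σ A (λ a → χ a ≡ i)

  Col : Set
  Col = (i : Fin m) → D i

  _≈C_ : Rel Col 0ℓ
  c ≈C c' = ∀ i → proj₁ (c i) ≡ proj₁ (c' i)

  ≈C-equiv : IsEquivalence _≈C_
  ≈C-equiv = record
    { refl = λ i → refl ; sym = λ p i → sym (p i)
    ; trans = λ p q i → trans (p i) (q i) }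

  data COp : Set where
    dOp : COp
    fOp : (f : Op S) → (Fin (arity S f) → Fin m) → COp

  CSig : Signature
  CSig = record { Op = COp ; arity = ar }
    where
    ar : COp → ℕ
    ar dOp        = m
    ar (fOp f is) = arity S f

  dC : (Fin m → Col) → Col
  dC cs i = cs i i

  first : ∀ f → Fin (arity S f)
  first f = fromℕ< (nn f)

  newval : ∀ f (is : Fin (arity S f) → Fin m) →
           (Fin (arity S f) → Col) → A
  newval f is cs = op oA f (λ l → proj₁ (cs l (is l)))

  newval-χ : ∀ f is cs → χ (newval f is cs) ≡ op oI f is
  newval-χ f is cs =
    trans (hom f _) (op-ext oI f _ _ (λ l → proj₂ (cs l (is l))))

  fhat : ∀ f (is : Fin (arity S f) → Fin m) →
         (Fin (arity S f) → Col) → Col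
  fhat f is cs j with j ≟ op oI f is
  ... | yes p = newval f is cs , trans (newval-χ f is cs) (sym p)
  ... | no _  = cs (first f) j

  fhat-cong : ∀ f is (cs ds : Fin (arity S f) → Col) →
              (∀ l → cs l ≈C ds l) → fhat f is cs ≈C fhat f is ds
  fhat-cong f is cs ds e j with j ≟ op oI f is
  ... | yes p = op-ext oA f _ _ (λ l → e l (is l))
  ... | no _  = e (first f) j

  Cops : (g : COp) → (Fin (arity CSig g) → Col) → Col
  Cops dOp        = dC
  Cops (fOp f is) = fhat f is

  Cops-cong : ∀ g (cs ds : Fin (arity CSig g) → Col) →
              (∀ l → cs l ≈C ds l) → Cops g cs ≈C Cops g ds
  Cops-cong dOp        cs ds e i = e i i
  Cops-cong (fOp f is) cs ds e   = fhat-cong f is cs ds e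

  𝐂 : SAlg CSig
  𝐂 = record
    { Carrier = Col ; _≈_ = _≈C_ ; ≈-equiv = ≈C-equiv
    ; sop = Cops ; sop-cong = Cops-cong }

  _* : Rel A 0ℓ → Rel Col 0ℓ
  (γ *) a b = ∀ i → γ (proj₁ (a i)) (proj₁ (b i))

-- ρ* is a congruence of C with [ρ*, β*] = 0 because every entry of a C-term is an
-- A-term in the entries of its arguments, so the term condition for C holds entry
-- by entry. For maximality, a congruence σ of C with [σ, β*] = 0 induces on A the
-- relation "putting x or y into the same column gives σ-related columns". It is a
-- congruence, and [·, β] = 0 for it: an A-term is lifted to a C-term computing it at
-- one coordinate, and d masks all other coordinates by a constant column. Hence it
-- lies below (0 : β), and σ lies below its star since d isolates single entries.
module Submission where

open import Defs
open import Level using (0ℓ)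
open import Data.Nat using (ℕ; suc; _*_)
open import Data.Fin using (Fin; zero; suc; _≟_; combine; remQuot)
open import Data.Fin.Properties using (remQuot-combine)
open import Data.Sum using (_⊎_; inj₁; inj₂; [_,_])
open import Data.Product using (_,_; proj₁; proj₂; _×_; uncurry)
open import Function using (_∘_)
open import Relation.Nullary using (yes; no; ¬_; contradiction)
open import Relation.Binary using (Rel; IsEquivalence; Reflexive)
open import Relation.Binary.PropositionalEquality
  using (_≡_; refl; sym; trans; cong; subst; subst₂; module ≡-Reasoning)

choose : {X : Set} {m : ℕ} → Fin m → Fin m → X → X → X
choose j i x y with j ≟ i
... | yes _ = x
... | no _  = y

choose-≡ : {X : Set} {m : ℕ} (i : Fin m) (x y : X) → choose i i x y ≡ x
choose-≡ i x y with i ≟ i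
... | yes _  = refl
... | no i≢i = contradiction refl i≢i

choose-preserves : {X : Set} {m : ℕ} (R : Rel X 0ℓ) (j i : Fin m) {x x′ y y′ : X} →
                   R x x′ → R y y′ → R (choose j i x y) (choose j i x′ y′)
choose-preserves R j i Rxx′ Ryy′ with j ≟ i
... | yes _ = Rxx′
... | no _  = Ryy′

congruence-refl : ∀ {S} {𝕏 : SAlg S} {γ} → IsCongruence 𝕏 γ → Reflexive γ
congruence-refl γ-cong = IsEquivalence.refl (IsCongruence.isEquiv γ-cong)

module ColumnCentralizer (S : Signature) (nn : NoNullary S) (m : ℕ) (oI : Ops S (Fin m))
    (A : Set) (oA : Ops S A) (χ : A → Fin m) (hom : IsHom S oA oI χ) where

  open Column S nn m oI A oA χ hom public

  𝔸 : SAlg S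
  𝔸 = plain S A oA

  𝕀 : SAlg S
  𝕀 = plain S (Fin m) oI

  _⊆ᴬ_ : Rel A 0ℓ → Rel A 0ℓ → Set
  _⊆ᴬ_ = _⊆_ 𝔸

  _⊆ᶜ_ : Rel Col 0ℓ → Rel Col 0ℓ → Set
  _⊆ᶜ_ = _⊆_ 𝐂

  *-mono : ∀ {γ γ′} → γ ⊆ᴬ γ′ → (γ *) ⊆ᶜ (γ′ *)
  *-mono γ⊆γ′ aγ*b i = γ⊆γ′ (aγ*b i)

  *-isCongruence : ∀ {γ} → IsCongruence 𝔸 γ → IsCongruence 𝐂 (γ *)
  *-isCongruence {γ} γ-cong = record
    { isEquiv = record
        { refl  = λ i → E.refl
        ; sym   = λ p i → E.sym (p i)
        ; trans = λ p q i → E.trans (p i) (q i) }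
    ; ≈⊆     = λ e i → ≈⊆ (e i)
    ; compat = compat* }
    where
    open IsCongruence γ-cong
    module E = IsEquivalence isEquiv

    compat* : ∀ g (cs ds : Fin (arity CSig g) → Col) →
              (∀ l → (γ *) (cs l) (ds l)) → (γ *) (Cops g cs) (Cops g ds)
    compat* dOp        cs ds h i = h i i
    compat* (fOp f is) cs ds h j with j ≟ op oI f is
    ... | yes _ = compat f _ _ (λ l → h l (is l))
    ... | no _  = h (first f) j

  entryTerm : {V W : Set} → (V → Fin m → W) → Term CSig V → Fin m → Term S W
  entryTerm r (var v)             i = var (r v i)
  entryTerm r (app dOp ts)        i = entryTerm r (ts i) i
  entryTerm r (app (fOp f is) ts) j with j ≟ op oI f is
  ... | yes _ = app f (λ l → entryTerm r (ts l) (is l))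
  ... | no _  = entryTerm r (ts (first f)) j

  eval-entryTerm : {V W : Set} (r : V → Fin m → W) (env : W → A) (cenv : V → Col) →
                   (∀ v i → env (r v i) ≡ proj₁ (cenv v i)) →
                   ∀ t i → eval 𝔸 env (entryTerm r t i) ≡ proj₁ (eval 𝐂 cenv t i)
  eval-entryTerm r env cenv h (var v)             i = h v i
  eval-entryTerm r env cenv h (app dOp ts)        i = eval-entryTerm r env cenv h (ts i) i
  eval-entryTerm r env cenv h (app (fOp f is) ts) j with j ≟ op oI f is
  ... | yes _ = op-ext oA f _ _ (λ l → eval-entryTerm r env cenv h (ts l) (is l))
  ... | no _  = eval-entryTerm r env cenv h (ts (first f)) j

  flatten : {n : ℕ} → (Fin n → Col) → Fin (n * m) → A
  flatten cs = uncurry (λ k i → proj₁ (cs k i)) ∘ remQuot m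

  flatten-combine : {n : ℕ} (cs : Fin n → Col) (k : Fin n) (i : Fin m) →
                    flatten cs (combine k i) ≡ proj₁ (cs k i)
  flatten-combine cs k i = cong (uncurry (λ k i → proj₁ (cs k i))) (remQuot-combine k i)

  *-commZero : ∀ {ρ β} → CommZero 𝔸 ρ β → CommZero 𝐂 (ρ *) (β *)
  *-commZero [ρ,β]≡0 {p} {q} t a b c d aρ*b cβ*d ac≈ad j = begin
    proj₁ (eval 𝐂 [ b , c ] t j)                      ≡⟨ sym (entry b c) ⟩
    eval 𝔸 [ flatten b , flatten c ] (entryTerm split t j)
      ≡⟨ [ρ,β]≡0 (entryTerm split t j) (flatten a) (flatten b) (flatten c) (flatten d)
                 (λ z → aρ*b (proj₁ (remQuot {p} m z)) (proj₂ (remQuot {p} m z)))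
                 (λ z → cβ*d (proj₁ (remQuot {q} m z)) (proj₂ (remQuot {q} m z)))
                 (trans (entry a c) (trans (ac≈ad j) (sym (entry a d)))) ⟩
    eval 𝔸 [ flatten b , flatten d ] (entryTerm split t j) ≡⟨ entry b d ⟩
    proj₁ (eval 𝐂 [ b , d ] t j)                      ∎
    where
    open ≡-Reasoning

    split : Fin p ⊎ Fin q → Fin m → Fin (p * m) ⊎ Fin (q * m)
    split (inj₁ k) i = inj₁ (combine k i)
    split (inj₂ k) i = inj₂ (combine k i)

    entry : (u : Fin p → Col) (w : Fin q → Col) →
            eval 𝔸 [ flatten u , flatten w ] (entryTerm split t j) ≡ proj₁ (eval 𝐂 [ u , w ] t j)
    entry u w = eval-entryTerm split _ _
      (λ { (inj₁ k) → flatten-combine u k ; (inj₂ k) → flatten-combine w k }) t j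

  put : A → Col → Col
  put x c j with j ≟ χ x
  ... | yes j≡χx = x , sym j≡χx
  ... | no _     = c j

  put-hit : ∀ x c {j} → j ≡ χ x → proj₁ (put x c j) ≡ x
  put-hit x c {j} j≡χx with j ≟ χ x
  ... | yes _    = refl
  ... | no j≢χx  = contradiction j≡χx j≢χx

  put-miss : ∀ x c {j} → ¬ j ≡ χ x → proj₁ (put x c j) ≡ proj₁ (c j)
  put-miss x c {j} j≢χx with j ≟ χ x
  ... | yes j≡χx = contradiction j≡χx j≢χx
  ... | no _     = refl

  put-* : ∀ {γ} → Reflexive γ → γ ⊆ᴬ ker χ → ∀ {x y} c → γ x y → (γ *) (put x c) (put y c)
  put-* {γ} γ-refl γ⊆α {x} {y} c xγy j with j ≟ χ x
  ... | yes j≡χx = subst (γ x) (sym (put-hit y c (trans j≡χx (γ⊆α xγy)))) xγy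
  ... | no j≢χx  = subst (γ (proj₁ (c j)))
                          (sym (put-miss y c (λ j≡χy → j≢χx (trans j≡χy (sym (γ⊆α xγy)))))) γ-refl

  fhat-at : ∀ f is cs → proj₁ (fhat f is cs (op oI f is)) ≡ newval f is cs
  fhat-at f is cs with op oI f is ≟ op oI f is
  ... | yes _    = refl
  ... | no ≢refl = contradiction refl ≢refl

  fhat-put-at : ∀ f is (xs : Fin (arity S f) → A) c → (∀ l → χ (xs l) ≡ is l) →
                proj₁ (fhat f is (λ l → put (xs l) c) (op oI f is)) ≡ op oA f xs
  fhat-put-at f is xs c χxs≡is =
    trans (fhat-at f is _) (op-ext oA f _ _ (λ l → put-hit (xs l) c (sym (χxs≡is l))))

  put-entry≈d : ∀ (a c : Col) i → put (proj₁ (a i)) c ≈C dC (λ j → choose j i a c)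
  put-entry≈d a c i j with j ≟ i
  ... | yes refl = put-hit _ c (sym (proj₂ (a j)))
  ... | no j≢i   = put-miss _ c (λ j≡ → j≢i (trans j≡ (proj₂ (a i))))

  congruence-put-entry : ∀ {σ} → IsCongruence 𝐂 σ →
                         ∀ {a b} c i → σ a b → σ (put (proj₁ (a i)) c) (put (proj₁ (b i)) c)
  congruence-put-entry {σ} σ-cong {a} {b} c i aσb =
    E.trans (≈⊆ (put-entry≈d a c i))
      (E.trans (compat dOp _ _ (λ j → choose-preserves σ j i aσb E.refl))
               (E.sym (≈⊆ (put-entry≈d b c i))))
    where
    open IsCongruence σ-cong
    module E = IsEquivalence isEquiv

  lower : Rel Col 0ℓ → Rel A 0ℓ
  lower σ x y = χ x ≡ χ y × (∀ c → σ (put x c) (put y c))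

  ⊆-*-lower : ∀ {σ} → IsCongruence 𝐂 σ → σ ⊆ᶜ (lower σ *)
  ⊆-*-lower σ-cong {a} {b} aσb i =
    trans (proj₂ (a i)) (sym (proj₂ (b i))) , λ c → congruence-put-entry σ-cong c i aσb

  lower-isCongruence : ∀ {σ} → IsCongruence 𝐂 σ → IsCongruence 𝔸 (lower σ)
  lower-isCongruence {σ} σ-cong = record
    { isEquiv = record
        { refl  = refl , λ c → E.refl
        ; sym   = λ (p , q) → sym p , λ c → E.sym (q c)
        ; trans = λ (p , q) (p′ , q′) → trans p p′ , λ c → E.trans (q c) (q′ c) }
    ; ≈⊆     = λ { refl → refl , λ c → E.refl }
    ; compat = compat-lower }
    where
    open IsCongruence σ-cong
    module E = IsEquivalence isEquiv

    compat-lower : ∀ f (xs ys : Fin (arity S f) → A) → (∀ l → lower σ (xs l) (ys l)) →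
                   lower σ (op oA f xs) (op oA f ys)
    compat-lower f xs ys h =
      trans (hom f xs) (trans (op-ext oI f _ _ (proj₁ ∘ h)) (sym (hom f ys))) , put-op
      where
      is : Fin (arity S f) → Fin m
      is = χ ∘ xs

      put-op : ∀ c → σ (put (op oA f xs) c) (put (op oA f ys) c)
      put-op c = subst₂ (λ x y → σ (put x c) (put y c))
        (fhat-put-at f is xs c (λ l → refl))
        (fhat-put-at f is ys c (λ l → sym (proj₁ (h l))))
        (congruence-put-entry σ-cong c (op oI f is)
          (compat (fOp f is) _ _ (λ l → proj₂ (h l) c)))

  liftTerm : {V W : Set} → (V → Fin m) → (V → W) → Term S V → Term CSig W
  liftTerm κ r (var v)    = var (r v)
  liftTerm κ r (app f ts) = app (fOp f (λ l → eval 𝕀 κ (ts l))) (λ l → liftTerm κ r (ts l))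

  eval-liftTerm : {V W : Set} (κ : V → Fin m) (r : V → W) (env : V → A) (cenv : W → Col) →
                  (∀ v → proj₁ (cenv (r v) (κ v)) ≡ env v) →
                  ∀ t → proj₁ (eval 𝐂 cenv (liftTerm κ r t) (eval 𝕀 κ t)) ≡ eval 𝔸 env t
  eval-liftTerm κ r env cenv h (var v)    = h v
  eval-liftTerm κ r env cenv h (app f ts) =
    trans (fhat-at f _ _) (op-ext oA f _ _ (λ l → eval-liftTerm κ r env cenv h (ts l)))

  focus : {W : Set} → Fin m → Term CSig W → W → Term CSig W
  focus i T z = app dOp (λ j → choose j i T (var z))

  eval-focus-at : {W : Set} (env : W → Col) → ∀ i T z → eval 𝐂 env (focus i T z) i ≡ eval 𝐂 env T i
  eval-focus-at env i T z = cong (λ s → eval 𝐂 env s i) (choose-≡ i T (var z))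

  focus-≈C : {W : Set} (env env′ : W → Col) → ∀ i T z →
             proj₁ (eval 𝐂 env T i) ≡ proj₁ (eval 𝐂 env′ T i) → env z ≈C env′ z →
             eval 𝐂 env (focus i T z) ≈C eval 𝐂 env′ (focus i T z)
  focus-≈C env env′ i T z at-i elsewhere j with j ≟ i
  ... | yes refl = at-i
  ... | no _     = elsewhere j

  lower-commZero : ∀ {σ β} → Col → Reflexive σ → Reflexive β → β ⊆ᴬ ker χ →
                   CommZero 𝐂 σ (β *) → CommZero 𝔸 (lower σ) β
  lower-commZero {σ} {β} c₀ σ-refl β-refl β⊆α [σ,β*]≡0 {p} {q} t a b c d a∼b cβd ac≡ad = begin
    eval 𝔸 [ b , c ] t                           ≡⟨ sym (focused b c χb≡χa (λ _ → refl)) ⟩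
    proj₁ (eval 𝐂 (columns b c) T i₀)
      ≡⟨ [σ,β*]≡0 T (ρ-cols a) (ρ-cols b) (β-cols c) (β-cols d) ρ-related β-related agree i₀ ⟩
    proj₁ (eval 𝐂 (columns b d) T i₀)            ≡⟨ focused b d χb≡χa χd≡χc ⟩
    eval 𝔸 [ b , d ] t                           ∎
    where
    open ≡-Reasoning

    χb≡χa : ∀ k → χ (b k) ≡ χ (a k)
    χb≡χa k = sym (proj₁ (a∼b k))

    χd≡χc : ∀ k → χ (d k) ≡ χ (c k)
    χd≡χc k = sym (β⊆α (cβd k))

    κ : Fin p ⊎ Fin q → Fin m
    κ = [ χ ∘ a , χ ∘ c ]

    i₀ : Fin m
    i₀ = eval 𝕀 κ t

    shift : Fin p ⊎ Fin q → Fin (suc p) ⊎ Fin q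
    shift = [ inj₁ ∘ suc , inj₂ ]

    -- The new ρ-variable zero holds c₀ in every evaluation below, so T takes the
    -- same value away from i₀ whichever columns are substituted.
    L T : Term CSig (Fin (suc p) ⊎ Fin q)
    L = liftTerm κ shift t
    T = focus i₀ L (inj₁ zero)

    ρ-cols : (Fin p → A) → Fin (suc p) → Col
    ρ-cols u zero    = c₀
    ρ-cols u (suc k) = put (u k) c₀

    β-cols : (Fin q → A) → Fin q → Col
    β-cols w k = put (w k) c₀

    columns : (Fin p → A) → (Fin q → A) → Fin (suc p) ⊎ Fin q → Col
    columns u w = [ ρ-cols u , β-cols w ]

    lifted : (u : Fin p → A) (w : Fin q → A) →
             (∀ k → χ (u k) ≡ χ (a k)) → (∀ k → χ (w k) ≡ χ (c k)) →
             proj₁ (eval 𝐂 (columns u w) L i₀) ≡ eval 𝔸 [ u , w ] t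
    lifted u w χu χw = eval-liftTerm κ shift [ u , w ] (columns u w) hit t
      where
      hit : ∀ v → proj₁ (columns u w (shift v) (κ v)) ≡ [ u , w ] v
      hit (inj₁ k) = put-hit (u k) c₀ (sym (χu k))
      hit (inj₂ k) = put-hit (w k) c₀ (sym (χw k))

    focused : (u : Fin p → A) (w : Fin q → A) →
              (∀ k → χ (u k) ≡ χ (a k)) → (∀ k → χ (w k) ≡ χ (c k)) →
              proj₁ (eval 𝐂 (columns u w) T i₀) ≡ eval 𝔸 [ u , w ] t
    focused u w χu χw = trans (cong proj₁ (eval-focus-at (columns u w) i₀ L _)) (lifted u w χu χw)

    ρ-related : ∀ k → σ (ρ-cols a k) (ρ-cols b k)
    ρ-related zero    = σ-refl
    ρ-related (suc k) = proj₂ (a∼b k) c₀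

    β-related : ∀ k → (β *) (β-cols c k) (β-cols d k)
    β-related k = put-* β-refl β⊆α c₀ (cβd k)

    agree : eval 𝐂 (columns a c) T ≈C eval 𝐂 (columns a d) T
    agree = focus-≈C (columns a c) (columns a d) i₀ _ _
      (trans (lifted a c (λ _ → refl) (λ _ → refl))
             (trans ac≡ad (sym (lifted a d (λ _ → refl) χd≡χc))))
      (λ _ → refl)

corollary3p7 : (S : Signature) (nn : NoNullary S) (m : ℕ) (oI : Ops S (Fin m))
    (A : Set) (oA : Ops S A) (χ : A → Fin m) (hom : IsHom S oA oI χ) →
    Surjective χ →
    (β ρ : Rel A 0ℓ) →
    IsCongruence (plain S A oA) β →
    _⊆_ (plain S A oA) β (ker χ) →
    IsCentralizer (plain S A oA) ρ β →
    _⊆_ (plain S A oA) ρ (ker χ) →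
    IsCentralizer (Column.𝐂 S nn m oI A oA χ hom)
    (Column._* S nn m oI A oA χ hom ρ)
    (Column._* S nn m oI A oA χ hom β)
corollary3p7 S nn m oI A oA χ hom surj β ρ β-cong β⊆α ρ-centralizer _ = record
  { cong-ρ  = *-isCongruence cong-ρ
  ; comm0   = *-commZero {ρ} {β} comm0
  ; largest = maximal }
  where
  open ColumnCentralizer S nn m oI A oA χ hom
  open IsCentralizer ρ-centralizer

  maximal : ∀ σ → IsCongruence 𝐂 σ → CommZero 𝐂 σ (β *) → σ ⊆ᶜ (ρ *)
  maximal σ σ-cong [σ,β*]≡0 {a} {b} aσb = *-mono {lower σ} {ρ}
    (largest (lower σ) (lower-isCongruence σ-cong)
      -- a witness of surjectivity of χ is precisely a column
      (lower-commZero {σ} {β} surj (congruence-refl σ-cong) (congruence-refl β-cong) β⊆α [σ,β*]≡0))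
    {a} {b} (⊆-*-lower σ-cong aσb)
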